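{- Let $k\ge0$ be an integer and let $\mathcal{X}$ be a nonempty collection of sets, each of which has size at most $k+1$, such that $\bigcap_{X\in\mathcal{X}}X=\emptyset$. Then there is a sub-collection $\mathcal{Y}\subseteq\mathcal{X}$ such that $\bigcap_{X\in\mathcal{Y}}X=\emptyset$ and $\left|\bigcup_{X\in\mathcal{Y}}X\right|\le\left(\frac{k+3}{2}\right)^2$. -}

module Defs where

open import Data.List.Membership.Propositional using () renaming (_∈_ to _∈ₗ_) public

-- Choose X₀, X₁ ∈ 𝒳 with |X₀ ∩ X₁| = t minimal, and for every x ∈ X₀ ∩ X₁ some
-- Z_x ∈ 𝒳 missing x. The t + 2 sets X₀, X₁, Z_x have empty intersection. By minimality
-- Z_x meets X₀ and X₁ in at least t points each but meets X₀ ∩ X₁ in fewer than t, so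
-- Z_x meets X₀ ∪ X₁ in at least t + 1 points and adds at most k − t new ones. Hence the
-- union has at most 2(k + 1) − t + t(k − t) = (t + 2)(k − t + 1) elements, and
-- 4ab ≤ (a + b)² with a + b = k + 3.
module Submission where

open import Defs
open import Data.Nat using (ℕ; suc; _≤_; _<_; _*_; _+_; _∸_; _^_)
open import Data.Nat.Properties
open import Data.Nat.Solver using (module +-*-Solver)
open +-*-Solver using (solve; _:*_; _:+_; _:^_; con; _:=_)
open import Data.Fin using (Fin) renaming (zero to fzero; suc to fsuc)
open import Data.Fin.Subset using (Subset; inside; outside; ⋂; ⋃; ∣_∣; ⊥; _∩_; _∪_; _∈_; _∉_; _⊆_; _⊂_)
open import Data.Fin.Subset.Properties
  using (x∈p∩q⁺; x∈p∩q⁻; p⊆q⇒∣p∣≤∣q∣; p⊂q⇒∣p∣<∣q∣; ∩-distribˡ-∪; ∪-assoc; ∪-comm; ∪-identityˡ; q⊆p∪q; ∈⊤; _∈?_; ∉⊥; Empty-unique)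
open import Data.Vec using (_∷_; []; here; there)
open import Data.List using (List; []; _∷_; map; length; cartesianProduct)
open import Data.List.Relation.Binary.Subset.Propositional using () renaming (_⊆_ to _⊆ₗ_)
open import Data.List.Relation.Unary.Any using (here; there)
open import Data.List.Relation.Unary.All as All using (All; _∷_; [])
open import Data.List.Relation.Unary.All.Properties using (¬All⇒Any¬)
open import Data.List.Membership.Propositional using (find)
open import Data.List.Membership.Propositional.Properties using (∈-map⁺; ∈-map⁻; ∈-cartesianProduct⁺; ∈-cartesianProduct⁻)
open import Data.List.Properties using (length-map)
import Data.List.Extrema.Nat as Extrema
open import Data.Product using (Σ; _×_; _,_; proj₁; proj₂; ∃; ∃₂)
open import Data.Sum using (inj₁; inj₂)
open import Data.Empty using (⊥-elim)
open import Function using (_∘_)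
open import Relation.Binary.PropositionalEquality using (_≡_; _≢_; refl; sym; trans; cong; subst; subst₂)

private
  variable
    n : ℕ

private
  square-of-sum : ∀ m d → 4 * (m * (m + d)) + d * d ≡ (m + (m + d)) ^ 2
  square-of-sum = solve 2 (λ m d → con 4 :* (m :* (m :+ d)) :+ d :* d := (m :+ (m :+ d)) :^ 2) refl

  4*[m*n]≤[m+n]^2-ordered : ∀ {m n} → m ≤ n → 4 * (m * n) ≤ (m + n) ^ 2
  4*[m*n]≤[m+n]^2-ordered {m} m≤n with d , refl ← m≤n⇒∃[o]m+o≡n m≤n =
    ≤-trans (m≤m+n _ (d * d)) (≤-reflexive (square-of-sum m d))

4*[m*n]≤[m+n]^2 : ∀ m n → 4 * (m * n) ≤ (m + n) ^ 2
4*[m*n]≤[m+n]^2 m n with ≤-total m n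
... | inj₁ m≤n = 4*[m*n]≤[m+n]^2-ordered m≤n
... | inj₂ n≤m = subst₂ _≤_ (cong (4 *_) (*-comm n m)) (cong (_^ 2) (+-comm n m))
                   (4*[m*n]≤[m+n]^2-ordered n≤m)

u≤m*n⇒4*u≤[m+n]^2 : ∀ {u s} m n → u ≤ m * n → m + n ≡ s → 4 * u ≤ s ^ 2
u≤m*n⇒4*u≤[m+n]^2 m n u≤mn refl = ≤-trans (*-monoʳ-≤ 4 u≤mn) (4*[m*n]≤[m+n]^2 m n)

-- For t ≤ k this is 4ab ≤ (a + b)² with a = t + 2, b = k − t + 1; for t > k the
-- truncated k ∸ t is 0 and u ≤ k + 2 suffices.
4*u≤[k+3]^2 : ∀ k t u b → u ≤ t * (k ∸ t) + b → b + t ≤ (k + 1) + (k + 1) → 4 * u ≤ (k + 3) ^ 2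
4*u≤[k+3]^2 k t u b u≤ b+t≤ with ≤-total t k
... | inj₁ t≤k with c , refl ← m≤n⇒∃[o]m+o≡n t≤k rewrite m+n∸m≡n t c =
  u≤m*n⇒4*u≤[m+n]^2 (t + 2) (c + 1) (+-cancelʳ-≤ t u _ (≤-trans u+t≤ (≤-reflexive (expand t c)))) (sum-of-factors t c)
  where
  u+t≤ : u + t ≤ t * c + ((t + c + 1) + (t + c + 1))
  u+t≤ = ≤-trans (+-monoˡ-≤ t u≤) (≤-trans (≤-reflexive (+-assoc (t * c) b t)) (+-monoʳ-≤ (t * c) b+t≤))
  expand : ∀ t c → t * c + ((t + c + 1) + (t + c + 1)) ≡ (t + 2) * (c + 1) + t
  expand = solve 2 (λ t c → t :* c :+ ((t :+ c :+ con 1) :+ (t :+ c :+ con 1)) := (t :+ con 2) :* (c :+ con 1) :+ t) refl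
  sum-of-factors : ∀ t c → (t + 2) + (c + 1) ≡ t + c + 3
  sum-of-factors = solve 2 (λ t c → (t :+ con 2) :+ (c :+ con 1) := t :+ c :+ con 3) refl
... | inj₂ k≤t = u≤m*n⇒4*u≤[m+n]^2 (k + 2) 1 (≤-trans u≤ (≤-trans t*[k∸t]+b≤k+2 (≤-reflexive (sym (*-identityʳ _))))) (+-assoc k 2 1)
  where
  t*[k∸t]+b≤k+2 : t * (k ∸ t) + b ≤ k + 2
  t*[k∸t]+b≤k+2 rewrite m≤n⇒m∸n≡0 k≤t | *-zeroʳ t = +-cancelʳ-≤ k b (k + 2) (begin
    b + k             ≤⟨ +-monoʳ-≤ b k≤t ⟩
    b + t             ≤⟨ b+t≤ ⟩
    (k + 1) + (k + 1) ≡⟨ solve 1 (λ k → (k :+ con 1) :+ (k :+ con 1) := (k :+ con 2) :+ k) refl k ⟩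
    (k + 2) + k       ∎)
    where open ≤-Reasoning

∣p∪q∣+∣p∩q∣≡∣p∣+∣q∣ : (p q : Subset n) → ∣ p ∪ q ∣ + ∣ p ∩ q ∣ ≡ ∣ p ∣ + ∣ q ∣
∣p∪q∣+∣p∩q∣≡∣p∣+∣q∣ []            []            = refl
∣p∪q∣+∣p∩q∣≡∣p∣+∣q∣ (inside  ∷ p) (inside  ∷ q) =
  cong suc (trans (+-suc _ _) (trans (cong suc (∣p∪q∣+∣p∩q∣≡∣p∣+∣q∣ p q)) (sym (+-suc _ _))))
∣p∪q∣+∣p∩q∣≡∣p∣+∣q∣ (inside  ∷ p) (outside ∷ q) = cong suc (∣p∪q∣+∣p∩q∣≡∣p∣+∣q∣ p q)
∣p∪q∣+∣p∩q∣≡∣p∣+∣q∣ (outside ∷ p) (inside  ∷ q) =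
  trans (cong suc (∣p∪q∣+∣p∩q∣≡∣p∣+∣q∣ p q)) (sym (+-suc _ _))
∣p∪q∣+∣p∩q∣≡∣p∣+∣q∣ (outside ∷ p) (outside ∷ q) = ∣p∪q∣+∣p∩q∣≡∣p∣+∣q∣ p q

∩-monoʳ-⊆ : ∀ (p : Subset n) {q r} → q ⊆ r → p ∩ q ⊆ p ∩ r
∩-monoʳ-⊆ p {q} q⊆r x∈p∩q with x∈p , x∈q ← x∈p∩q⁻ p q x∈p∩q = x∈p∩q⁺ (x∈p , q⊆r x∈q)

∣p∪q∣≤c+∣q∣ : ∀ c (p q : Subset n) → ∣ p ∣ ≤ c + ∣ p ∩ q ∣ → ∣ p ∪ q ∣ ≤ c + ∣ q ∣
∣p∪q∣≤c+∣q∣ c p q ∣p∣≤ = +-cancelʳ-≤ ∣ p ∩ q ∣ _ _ (begin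
  ∣ p ∪ q ∣ + ∣ p ∩ q ∣   ≡⟨ ∣p∪q∣+∣p∩q∣≡∣p∣+∣q∣ p q ⟩
  ∣ p ∣ + ∣ q ∣           ≤⟨ +-monoˡ-≤ ∣ q ∣ ∣p∣≤ ⟩
  c + ∣ p ∩ q ∣ + ∣ q ∣   ≡⟨ solve 3 (λ c i q → c :+ i :+ q := c :+ q :+ i) refl c ∣ p ∩ q ∣ ∣ q ∣ ⟩
  c + ∣ q ∣ + ∣ p ∩ q ∣   ∎)
  where open ≤-Reasoning

∣⋃ps∪b∣≤∣ps∣*c+∣b∣ : ∀ c (b : Subset n) ps → (∀ {p} → p ∈ₗ ps → ∣ p ∣ ≤ c + ∣ p ∩ b ∣) →
                      ∣ ⋃ ps ∪ b ∣ ≤ length ps * c + ∣ b ∣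
∣⋃ps∪b∣≤∣ps∣*c+∣b∣ c b []       _   = ≤-reflexive (cong ∣_∣ (∪-identityˡ b))
∣⋃ps∪b∣≤∣ps∣*c+∣b∣ c b (p ∷ ps) few = begin
  ∣ (p ∪ ⋃ ps) ∪ b ∣            ≡⟨ cong ∣_∣ (∪-assoc p (⋃ ps) b) ⟩
  ∣ p ∪ (⋃ ps ∪ b) ∣            ≤⟨ ∣p∪q∣≤c+∣q∣ c p (⋃ ps ∪ b) ∣p∣≤ ⟩
  c + ∣ ⋃ ps ∪ b ∣              ≤⟨ +-monoʳ-≤ c (∣⋃ps∪b∣≤∣ps∣*c+∣b∣ c b ps (few ∘ there)) ⟩
  c + (length ps * c + ∣ b ∣)   ≡⟨ sym (+-assoc c _ _) ⟩
  c + length ps * c + ∣ b ∣     ∎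
  where
  open ≤-Reasoning
  ∣p∣≤ : ∣ p ∣ ≤ c + ∣ p ∩ (⋃ ps ∪ b) ∣
  ∣p∣≤ = ≤-trans (few (here refl))
           (+-monoʳ-≤ c (p⊆q⇒∣p∣≤∣q∣ (∩-monoʳ-⊆ p (q⊆p∪q (⋃ ps) b))))

elements : Subset n → List (Fin n)
elements []            = []
elements (inside  ∷ p) = fzero ∷ map fsuc (elements p)
elements (outside ∷ p) = map fsuc (elements p)

length-elements : (p : Subset n) → length (elements p) ≡ ∣ p ∣
length-elements []            = refl
length-elements (inside  ∷ p) = cong suc (trans (length-map fsuc (elements p)) (length-elements p))
length-elements (outside ∷ p) = trans (length-map fsuc (elements p)) (length-elements p)

∈-elements⁺ : ∀ {x : Fin n} p → x ∈ p → x ∈ₗ elements p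
∈-elements⁺ (inside  ∷ p) here        = here refl
∈-elements⁺ (inside  ∷ p) (there x∈p) = there (∈-map⁺ fsuc (∈-elements⁺ p x∈p))
∈-elements⁺ (outside ∷ p) (there x∈p) = ∈-map⁺ fsuc (∈-elements⁺ p x∈p)

∈-elements⁻ : ∀ {x : Fin n} p → x ∈ₗ elements p → x ∈ p
∈-elements⁻ (inside  ∷ p) (here refl) = here
∈-elements⁻ (inside  ∷ p) (there x∈)
  with y , y∈ , refl ← ∈-map⁻ fsuc x∈ = there (∈-elements⁻ p y∈)
∈-elements⁻ (outside ∷ p) x∈
  with y , y∈ , refl ← ∈-map⁻ fsuc x∈ = there (∈-elements⁻ p y∈)

∈-⋂⁺ : ∀ {x : Fin n} {ps} → All (x ∈_) ps → x ∈ ⋂ ps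
∈-⋂⁺ []           = ∈⊤
∈-⋂⁺ (x∈p ∷ x∈ps) = x∈p∩q⁺ (x∈p , ∈-⋂⁺ x∈ps)

∈-⋂⁻ : ∀ {x : Fin n} ps → x ∈ ⋂ ps → All (x ∈_) ps
∈-⋂⁻ []       _    = []
∈-⋂⁻ (p ∷ ps) x∈⋂ with x∈p , x∈⋂ps ← x∈p∩q⁻ p (⋂ ps) x∈⋂ = x∈p ∷ ∈-⋂⁻ ps x∈⋂ps

⋂≡⊥⇒∃∉ : ∀ (ps : List (Subset n)) → ⋂ ps ≡ ⊥ → ∀ x → ∃ λ p → p ∈ₗ ps × x ∉ p
⋂≡⊥⇒∃∉ ps ⋂≡⊥ x =
  find (¬All⇒Any¬ (x ∈?_) ps λ x∈ps → ∉⊥ (subst (x ∈_) ⋂≡⊥ (∈-⋂⁺ x∈ps)))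

minimiser : ∀ {a} {A : Set a} (f : A → ℕ) xs → xs ≢ [] →
            ∃ λ m → m ∈ₗ xs × ∀ {y} → y ∈ₗ xs → f m ≤ f y
minimiser f []       []≢[] = ⊥-elim ([]≢[] refl)
minimiser f (x ∷ xs) _     = argmin f x xs , argmin∈ , minimal
  where
  open Extrema
  argmin∈ : argmin f x xs ∈ₗ x ∷ xs
  argmin∈ with argmin-sel f x xs
  ... | inj₁ ≡x = here ≡x
  ... | inj₂ ∈xs = there ∈xs
  minimal : ∀ {y} → y ∈ₗ x ∷ xs → f (argmin f x xs) ≤ f y
  minimal (here refl) = f[argmin]≤f[⊤] {f = f} x xs
  minimal (there y∈)  = All.lookup (f[argmin]≤f[xs] {f = f} x xs) y∈

minimal-pair : (𝒳 : List (Subset n)) → 𝒳 ≢ [] →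
  ∃₂ λ X₀ X₁ → X₀ ∈ₗ 𝒳 × X₁ ∈ₗ 𝒳 ×
    (∀ {Z} → Z ∈ₗ 𝒳 → ∣ X₀ ∩ X₁ ∣ ≤ ∣ Z ∩ X₀ ∣ × ∣ X₀ ∩ X₁ ∣ ≤ ∣ Z ∩ X₁ ∣)
minimal-pair []          []≢[] = ⊥-elim ([]≢[] refl)
minimal-pair 𝒳@(X ∷ _) _
  with (X₀ , X₁) , X₀X₁∈ , minimal ← minimiser (λ (P , Q) → ∣ P ∩ Q ∣) (cartesianProduct 𝒳 𝒳) (λ ())
  with X₀∈ , X₁∈ ← ∈-cartesianProduct⁻ 𝒳 𝒳 X₀X₁∈
  = X₀ , X₁ , X₀∈ , X₁∈ , λ Z∈ → minimal (∈-cartesianProduct⁺ Z∈ X₀∈) , minimal (∈-cartesianProduct⁺ Z∈ X₁∈)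

module MinimalPair
  (k : ℕ) {n} {𝒳 : List (Subset n)}
  (small : ∀ {X} → X ∈ₗ 𝒳 → ∣ X ∣ ≤ k + 1) (⋂𝒳≡⊥ : ⋂ 𝒳 ≡ ⊥)
  {X₀ X₁} (X₀∈ : X₀ ∈ₗ 𝒳) (X₁∈ : X₁ ∈ₗ 𝒳)
  (minimal : ∀ {Z} → Z ∈ₗ 𝒳 → ∣ X₀ ∩ X₁ ∣ ≤ ∣ Z ∩ X₀ ∣ × ∣ X₀ ∩ X₁ ∣ ≤ ∣ Z ∩ X₁ ∣)
  where

  I B : Subset n
  I = X₀ ∩ X₁
  B = X₀ ∪ X₁

  t : ℕ
  t = ∣ I ∣

  missing : Fin n → Subset n
  missing x = proj₁ (⋂≡⊥⇒∃∉ 𝒳 ⋂𝒳≡⊥ x)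

  missing∈𝒳 : ∀ x → missing x ∈ₗ 𝒳
  missing∈𝒳 x = proj₁ (proj₂ (⋂≡⊥⇒∃∉ 𝒳 ⋂𝒳≡⊥ x))

  x∉missing : ∀ x → x ∉ missing x
  x∉missing x = proj₂ (proj₂ (⋂≡⊥⇒∃∉ 𝒳 ⋂𝒳≡⊥ x))

  𝒵 𝒴 : List (Subset n)
  𝒵 = map missing (elements I)
  𝒴 = X₀ ∷ X₁ ∷ 𝒵

  𝒴⊆𝒳 : 𝒴 ⊆ₗ 𝒳
  𝒴⊆𝒳 (here refl)         = X₀∈
  𝒴⊆𝒳 (there (here refl)) = X₁∈
  𝒴⊆𝒳 (there (there Z∈))
    with x , _ , refl ← ∈-map⁻ missing Z∈ = missing∈𝒳 x

  ∉⋂𝒴 : ∀ x → x ∉ ⋂ 𝒴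
  ∉⋂𝒴 x x∈⋂𝒴 with x∈X₀ ∷ x∈X₁ ∷ x∈𝒵 ← ∈-⋂⁻ 𝒴 x∈⋂𝒴 =
    x∉missing x (All.lookup x∈𝒵 (∈-map⁺ missing (∈-elements⁺ I (x∈p∩q⁺ (x∈X₀ , x∈X₁)))))

  ⋂𝒴≡⊥ : ⋂ 𝒴 ≡ ⊥
  ⋂𝒴≡⊥ = Empty-unique λ (x , x∈⋂𝒴) → ∉⋂𝒴 x x∈⋂𝒴

  t<∣missing∩B∣ : ∀ {x} → x ∈ I → t < ∣ missing x ∩ B ∣
  t<∣missing∩B∣ {x} x∈I = subst (t <_) (cong ∣_∣ (sym (∩-distribˡ-∪ Z X₀ X₁)))
    (+-cancelʳ-≤ ∣ P ∩ Q ∣ _ _ (begin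
      suc t + ∣ P ∩ Q ∣       ≡⟨ sym (+-suc t _) ⟩
      t + suc ∣ P ∩ Q ∣       ≤⟨ +-monoʳ-≤ t (p⊂q⇒∣p∣<∣q∣ P∩Q⊂I) ⟩
      t + t                   ≤⟨ +-mono-≤ (proj₁ (minimal Z∈𝒳)) (proj₂ (minimal Z∈𝒳)) ⟩
      ∣ P ∣ + ∣ Q ∣           ≡⟨ sym (∣p∪q∣+∣p∩q∣≡∣p∣+∣q∣ P Q) ⟩
      ∣ P ∪ Q ∣ + ∣ P ∩ Q ∣   ∎))
    where
    open ≤-Reasoning
    Z P Q : Subset n
    Z = missing x
    P = Z ∩ X₀
    Q = Z ∩ X₁
    Z∈𝒳 : Z ∈ₗ 𝒳
    Z∈𝒳 = missing∈𝒳 x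
    P∩Q⊆I : P ∩ Q ⊆ I
    P∩Q⊆I y∈P∩Q =
      let y∈P , y∈Q = x∈p∩q⁻ P Q y∈P∩Q
      in x∈p∩q⁺ (proj₂ (x∈p∩q⁻ Z X₀ y∈P) , proj₂ (x∈p∩q⁻ Z X₁ y∈Q))
    P∩Q⊂I : P ∩ Q ⊂ I
    P∩Q⊂I = P∩Q⊆I , x , x∈I , λ x∈P∩Q →
      x∉missing x (proj₁ (x∈p∩q⁻ Z X₀ (proj₁ (x∈p∩q⁻ P Q x∈P∩Q))))

  ∣Z∣≤k∸t+∣Z∩B∣ : ∀ {Z} → Z ∈ₗ 𝒵 → ∣ Z ∣ ≤ (k ∸ t) + ∣ Z ∩ B ∣
  ∣Z∣≤k∸t+∣Z∩B∣ Z∈ with x , x∈ , refl ← ∈-map⁻ missing Z∈ = begin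
    ∣ missing x ∣                ≤⟨ small (missing∈𝒳 x) ⟩
    k + 1                        ≤⟨ +-monoˡ-≤ 1 (m≤n+m∸n k t) ⟩
    t + (k ∸ t) + 1              ≡⟨ solve 2 (λ t c → t :+ c :+ con 1 := c :+ (con 1 :+ t)) refl t (k ∸ t) ⟩
    (k ∸ t) + suc t              ≤⟨ +-monoʳ-≤ (k ∸ t) (t<∣missing∩B∣ (∈-elements⁻ I x∈)) ⟩
    (k ∸ t) + ∣ missing x ∩ B ∣  ∎
    where open ≤-Reasoning

  4*∣⋃𝒴∣≤[k+3]^2 : 4 * ∣ ⋃ 𝒴 ∣ ≤ (k + 3) ^ 2
  4*∣⋃𝒴∣≤[k+3]^2 = 4*u≤[k+3]^2 k t ∣ ⋃ 𝒴 ∣ ∣ B ∣ ∣⋃𝒴∣≤ ∣B∣+t≤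
    where
    open ≤-Reasoning
    ∣⋃𝒴∣≤ : ∣ ⋃ 𝒴 ∣ ≤ t * (k ∸ t) + ∣ B ∣
    ∣⋃𝒴∣≤ = begin
      ∣ X₀ ∪ (X₁ ∪ ⋃ 𝒵) ∣          ≡⟨ cong ∣_∣ (trans (sym (∪-assoc X₀ X₁ (⋃ 𝒵))) (∪-comm B (⋃ 𝒵))) ⟩
      ∣ ⋃ 𝒵 ∪ B ∣                  ≤⟨ ∣⋃ps∪b∣≤∣ps∣*c+∣b∣ (k ∸ t) B 𝒵 ∣Z∣≤k∸t+∣Z∩B∣ ⟩
      length 𝒵 * (k ∸ t) + ∣ B ∣   ≡⟨ cong (λ l → l * (k ∸ t) + ∣ B ∣) length𝒵 ⟩
      t * (k ∸ t) + ∣ B ∣          ∎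
      where
      length𝒵 : length 𝒵 ≡ t
      length𝒵 = trans (length-map missing (elements I)) (length-elements I)
    ∣B∣+t≤ : ∣ B ∣ + t ≤ (k + 1) + (k + 1)
    ∣B∣+t≤ = ≤-trans (≤-reflexive (∣p∪q∣+∣p∩q∣≡∣p∣+∣q∣ X₀ X₁)) (+-mono-≤ (small X₀∈) (small X₁∈))

lemma3p7 : (k n : ℕ) (𝒳 : List (Subset n)) → 𝒳 ≢ [] → (∀ {X} → X ∈ₗ 𝒳 → ∣ X ∣ ≤ k + 1) → ⋂ 𝒳 ≡ ⊥
    → Σ (List (Subset n)) (λ 𝒴 → 𝒴 ⊆ₗ 𝒳 × 𝒴 ≢ [] × ⋂ 𝒴 ≡ ⊥ × 4 * ∣ ⋃ 𝒴 ∣ ≤ (k + 3) ^ 2)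
lemma3p7 k n 𝒳 𝒳≢[] small ⋂𝒳≡⊥
  with X₀ , X₁ , X₀∈ , X₁∈ , minimal ← minimal-pair 𝒳 𝒳≢[] =
  𝒴 , 𝒴⊆𝒳 , (λ ()) , ⋂𝒴≡⊥ , 4*∣⋃𝒴∣≤[k+3]^2
  where open MinimalPair k small ⋂𝒳≡⊥ X₀∈ X₁∈ minimal
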